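{- Let $G$ be a graph and let $C$ be (the vertex set of) a connected component of $G$ with $|C|\ge 2\delta(G)$. If $G[C]$ does not contain a Hamiltonian path, then either there exists a path $P_1$ in $G[C]$ such that $N(v)\subseteq V(P_1)$ for every $v\in C\setminus V(P_1)$, or there exist two vertex-disjoint paths $P_1,P_2$ with $|V(P_1)|+|V(P_2)|>3\delta(G)$.
   Context: $\delta(G)$ denotes the minimum degree of $G$. -}

module Defs where

open import Data.Nat using (ℕ; zero; suc; _⊓_)
open import Data.Bool using (Bool; true; false; T)
open import Data.Fin using (Fin; zero; suc)
open import Data.Fin.Subset using (Subset) renaming (_∈_ to _∈ₛ_; ∣_∣ to ∣_∣ₛ)
open import Data.Vec using (tabulate)
open import Data.List using (List; []; _∷_; length)
open import Data.List.Membership.Propositional using (_∈_; _∉_)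
open import Data.List.Relation.Unary.Unique.Propositional using (Unique)
open import Data.List.Relation.Unary.Linked using (Linked)
open import Data.List.Relation.Unary.All using (All)
open import Data.Product using (Σ; ∃; _×_; _,_)
open import Relation.Binary.PropositionalEquality using (_≡_; _≢_)
open import Relation.Binary.Construct.Closure.ReflexiveTransitive using (Star)
open import Function using (_∘_)

record Graph (n : ℕ) : Set where
  field
    adj    : Fin n → Fin n → Bool
    sym    : ∀ u v → adj u v ≡ adj v u
    irrefl : ∀ v → adj v v ≡ false

open Graph public

Adj : ∀ {n} → Graph n → Fin n → Fin n → Set
Adj G u v = T (adj G u v)

N : ∀ {n} → Graph n → Fin n → Subset n
N G v = tabulate (adj G v)

degree : ∀ {n} → Graph n → Fin n → ℕ
degree G v = ∣ N G v ∣ₛ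

minFin : ∀ {n} → (Fin (suc n) → ℕ) → ℕ
minFin {zero}  f = f zero
minFin {suc n} f = f zero ⊓ minFin (f ∘ suc)

-- minimum degree δ(G) (convention: 0 for the empty graph)
δ : ∀ {n} → Graph n → ℕ
δ {zero}  G = 0
δ {suc n} G = minFin (degree G)

IsPath : ∀ {n} → Graph n → List (Fin n) → Set
IsPath G P = (P ≢ []) × Unique P × Linked (Adj G) P

IsComponent : ∀ {n} → Graph n → Subset n → Set
IsComponent G C =
  (∃ λ v → v ∈ₛ C)
  × (∀ u v → u ∈ₛ C → v ∈ₛ C → Star (Adj G) u v)
  × (∀ u v → u ∈ₛ C → Adj G u v → v ∈ₛ C)

IsPathIn : ∀ {n} → Graph n → Subset n → List (Fin n) → Set
IsPathIn G C P = IsPath G P × All (_∈ₛ C) P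

IsHamPathIn : ∀ {n} → Graph n → Subset n → List (Fin n) → Set
IsHamPathIn G C P = IsPathIn G C P × (∀ v → v ∈ₛ C → v ∈ P)

{-# OPTIONS --safe #-}
module Submission where

-- Take a longest path P = v … v′ of G[C].  If no edge of G[C] avoids V(P), P is the first
-- alternative.  Otherwise let Q = u … be a longest path of G[C] − V(P); it has at least two
-- vertices, and as C is connected some w ∈ C − V(P) has a neighbour on P.  Maximality gives
-- N(v), N(v′) ⊆ V(P) and N(u) ⊆ V(P) ∪ V(Q).  Along P the three neighbourhoods avoid a few
-- local patterns, since each pattern would give a longer path: either by a Pósa rotation,
-- or by a cycle through V(P) (resp. V(P) minus one vertex), closed by the edges at v and v′,
-- to which w (resp. Q) is attached.  The patterns force
-- |N(v) ∩ P| + |N(v′) ∩ P| + |N(u) ∩ P| ≤ |P|, so 3δ ≤ deg v + deg v′ + deg u < |P| + |Q|.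

open import Defs hiding (sym; irrefl)
open import Level using (0ℓ)
open import Data.Bool using (Bool; true; false; T)
open import Data.Bool.Properties using (T?)
open import Data.Empty using (⊥-elim)
open import Data.Unit using (⊤)
open import Data.Nat using (ℕ; zero; suc; _≤_; _<_; _+_; _*_; z≤n; s≤s; s≤s⁻¹)
open import Data.Nat.Properties
  using (≤-refl; ≤-reflexive; ≤-trans; <⇒≱; <-irrefl; 1+n≰n; n<1+n; +-assoc; +-suc; +-identityʳ;
         +-mono-≤; +-monoˡ-≤; +-monoʳ-≤; +-monoʳ-<; m⊓n≤m; m⊓n≤n; module ≤-Reasoning)
open import Data.Nat.ListAction using (sum)
open import Data.Nat.Solver using (module +-*-Solver)
open import Data.Fin using (Fin; zero; suc; _≟_)
open import Data.Fin.Properties using (any?)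
open import Data.Fin.Subset using (Subset) renaming (_∈_ to _∈ₛ_; ∣_∣ to ∣_∣ₛ)
open import Data.Fin.Subset.Properties using () renaming (_∈?_ to _∈ₛ?_)
open import Data.Vec using (tabulate)
open import Data.List using (List; []; _∷_; _++_; _∷ʳ_; [_]; length; reverse; map; filter; allFin; cartesianProductWith)
import Data.List as List
open import Data.List.Properties
  using (++-assoc; ++-identityʳ; ∷ʳ-++; ∷-injectiveˡ; length-++; length-tabulate;
         reverse-++; unfold-reverse; reverse-involutive)
open import Data.List.Membership.Propositional using (_∈_; _∉_)
open import Data.List.Membership.Propositional.Properties
  using (∈-++⁺ˡ; ∈-++⁺ʳ; ∈-∃++; ∈-allFin; ∈-filter⁺; ∈-cartesianProductWith⁺)
import Data.List.Membership.DecPropositional as DecMembership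
open import Data.List.Relation.Unary.Any using (here; there)
open import Data.List.Relation.Unary.All as All using (All; []; _∷_; all?; head; lookup)
open import Data.List.Relation.Unary.All.Properties as Allₚ using (¬Any⇒All¬; all-filter)
open import Data.List.Relation.Unary.Linked as Linked using (Linked; []; [-]; _∷_; linked?)
open import Data.List.Relation.Unary.Unique.Propositional using (Unique; []; _∷_)
import Data.List.Relation.Unary.Unique.Propositional.Properties as Uniqueₚ
open import Data.List.Relation.Unary.Unique.DecPropositional using (unique?)
open import Data.List.Relation.Binary.Disjoint.Propositional using (Disjoint)
open import Data.List.Relation.Binary.Permutation.Propositional
  using (_↭_; ↭-sym; ↭-trans; ↭-reflexive; prep; ↭⇒↭ₛ; module PermutationReasoning)
open import Data.List.Relation.Binary.Permutation.Propositional.Properties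
  using (∈-resp-↭; All-resp-↭; ↭-length; ↭-empty-inv; ↭-reverse; shift; ++⁺ʳ; ++⁺ˡ; ++-comm)
import Data.List.Relation.Binary.Permutation.Setoid.Properties as Permutationₛ
open import Data.List.Extrema.Nat using (argmax; argmax-all; f[xs]≤f[argmax])
open import Data.Product using (Σ; _×_; _,_; proj₁; proj₂)
open import Data.Sum using (_⊎_; inj₁; inj₂)
open import Function using (_∘_; id; const)
open import Relation.Binary using (Rel; Symmetric)
open import Relation.Binary.Construct.Closure.ReflexiveTransitive using (Star; ε; _◅_)
open import Relation.Binary.PropositionalEquality
  using (_≡_; _≢_; refl; sym; trans; cong; subst; setoid; module ≡-Reasoning)
open import Relation.Nullary using (¬_; Dec; yes; no; ¬?)
open import Relation.Nullary.Decidable using (_×-dec_; decidable-stable)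
open import Relation.Unary using (Pred; Decidable)

-- Counting along lists

toℕ : Bool → ℕ
toℕ false = 0
toℕ true  = 1

toℕ≤1 : ∀ b → toℕ b ≤ 1
toℕ≤1 false = z≤n
toℕ≤1 true  = s≤s z≤n

toℕ-¬T : ∀ {b} → ¬ T b → toℕ b ≡ 0
toℕ-¬T {false} _  = refl
toℕ-¬T {true}  ¬t = ⊥-elim (¬t _)

true⇒T : ∀ {b} → b ≡ true → T b
true⇒T refl = _

countᵇ : ∀ {A : Set} → (A → Bool) → List A → ℕ
countᵇ f []       = 0
countᵇ f (a ∷ as) = toℕ (f a) + countᵇ f as

countᵇ≤length : ∀ {A : Set} (f : A → Bool) as → countᵇ f as ≤ length as
countᵇ≤length f []       = z≤n
countᵇ≤length f (a ∷ as) = +-mono-≤ (toℕ≤1 (f a)) (countᵇ≤length f as)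

countᵇ-++ : ∀ {A : Set} (f : A → Bool) as bs → countᵇ f (as ++ bs) ≡ countᵇ f as + countᵇ f bs
countᵇ-++ f []       bs = refl
countᵇ-++ f (a ∷ as) bs = trans (cong (toℕ (f a) +_) (countᵇ-++ f as bs)) (sym (+-assoc (toℕ (f a)) _ _))

countᵇ-const-true : ∀ {A : Set} (as : List A) → countᵇ (const true) as ≡ length as
countᵇ-const-true []       = refl
countᵇ-const-true (a ∷ as) = cong suc (countᵇ-const-true as)

∈-++-drop-mid : ∀ {A : Set} {v w : A} xs ys → w ∈ xs ++ v ∷ ys → w ≢ v → w ∈ xs ++ ys
∈-++-drop-mid []       ys (here w≡v) w≢v = ⊥-elim (w≢v w≡v)
∈-++-drop-mid []       ys (there w∈) w≢v = w∈
∈-++-drop-mid (x ∷ xs) ys (here w≡x) w≢v = here w≡x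
∈-++-drop-mid (x ∷ xs) ys (there w∈) w≢v = there (∈-++-drop-mid xs ys w∈ w≢v)

countᵇ-mono : ∀ {A : Set} (f : A → Bool) {as bs : List A} → Unique as →
              (∀ {a} → a ∈ as → T (f a) → a ∈ bs) → countᵇ f as ≤ countᵇ f bs
countᵇ-mono f {[]}     _            _     = z≤n
countᵇ-mono f {a ∷ as} (a∉as ∷ as!) as⊆bs with f a in fa
... | false = countᵇ-mono f as! (as⊆bs ∘ there)
... | true with bs₁ , bs₂ , refl ← ∈-∃++ (as⊆bs (here refl) (true⇒T fa)) = begin
  suc (countᵇ f as)                  ≤⟨ s≤s (countᵇ-mono f as! as⊆bs₁++bs₂) ⟩
  suc (countᵇ f (bs₁ ++ bs₂))        ≡⟨ cong suc (countᵇ-++ f bs₁ bs₂) ⟩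
  suc (countᵇ f bs₁ + countᵇ f bs₂)  ≡⟨ sym (+-suc _ _) ⟩
  countᵇ f bs₁ + suc (countᵇ f bs₂)  ≡⟨ cong (λ b → countᵇ f bs₁ + (toℕ b + countᵇ f bs₂)) (sym fa) ⟩
  countᵇ f bs₁ + countᵇ f (a ∷ bs₂)  ≡⟨ sym (countᵇ-++ f bs₁ (a ∷ bs₂)) ⟩
  countᵇ f (bs₁ ++ a ∷ bs₂)          ∎
  where
  open ≤-Reasoning
  as⊆bs₁++bs₂ : ∀ {w} → w ∈ as → T (f w) → w ∈ bs₁ ++ bs₂
  as⊆bs₁++bs₂ w∈as fw = ∈-++-drop-mid bs₁ bs₂ (as⊆bs (there w∈as) fw) (λ { refl → lookup a∉as w∈as refl })

∣tabulate∣≡countᵇ : ∀ {A : Set} {n} (f : A → Bool) (g : Fin n → A) →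
                    ∣ tabulate (f ∘ g) ∣ₛ ≡ countᵇ f (List.tabulate g)
∣tabulate∣≡countᵇ {n = zero}  f g = refl
∣tabulate∣≡countᵇ {n = suc n} f g with f (g zero)
... | true  = cong suc (∣tabulate∣≡countᵇ f (g ∘ suc))
... | false = ∣tabulate∣≡countᵇ f (g ∘ suc)

Unique⇒length≤ : ∀ {n} {vs : List (Fin n)} → Unique vs → length vs ≤ n
Unique⇒length≤ {n} {vs} vs! = begin
  length vs                      ≡⟨ sym (countᵇ-const-true vs) ⟩
  countᵇ (const true) vs         ≤⟨ countᵇ-mono (const true) vs! (λ {v} _ _ → ∈-allFin v) ⟩
  countᵇ (const true) (allFin n) ≡⟨ countᵇ-const-true (allFin n) ⟩
  length (allFin n)              ≡⟨ length-tabulate id ⟩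
  n                              ∎
  where open ≤-Reasoning

-- Longest lists satisfying a decidable, length-bounded property

module _ {A : Set} (as : List A) (complete : ∀ a → a ∈ as) where

  listsUpTo : ℕ → List (List A)
  listsUpTo zero    = [ [] ]
  listsUpTo (suc k) = [] ∷ cartesianProductWith _∷_ as (listsUpTo k)

  ∈-listsUpTo : ∀ {k} xs → length xs ≤ k → xs ∈ listsUpTo k
  ∈-listsUpTo {zero}  []       _      = here refl
  ∈-listsUpTo {suc k} []       _      = here refl
  ∈-listsUpTo {suc k} (x ∷ xs) |xs|≤k =
    there (∈-cartesianProductWith⁺ _∷_ (complete x) (∈-listsUpTo xs (s≤s⁻¹ |xs|≤k)))

  longest : ∀ {P : Pred (List A) 0ℓ} → Decidable P → (k : ℕ) → (∀ {xs} → P xs → length xs ≤ k) →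
            ∀ {xs₀} → P xs₀ → Σ (List A) λ xs → P xs × (∀ {ys} → P ys → length ys ≤ length xs)
  longest P? k bounded {xs₀} p₀ =
    argmax length xs₀ candidates ,
    argmax-all length p₀ (all-filter P? (listsUpTo k)) ,
    λ {ys} p → lookup (f[xs]≤f[argmax] xs₀ candidates) (∈-filter⁺ P? (∈-listsUpTo ys (bounded p)) p)
    where
    candidates : List (List A)
    candidates = filter P? (listsUpTo k)

-- Walks and closed walks

reverse-∷ : ∀ {A : Set} (x : A) xs → Σ A λ y → Σ (List A) λ ys → reverse (x ∷ xs) ≡ y ∷ ys
reverse-∷ x xs with reverse xs | unfold-reverse x xs
... | []     | rev≡ = x , [] , rev≡
... | y ∷ ys | rev≡ = y , ys ∷ʳ x , rev≡

reverse-split : ∀ {A : Set} pre (a : A) mid b rest →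
                reverse (pre ++ a ∷ mid ++ b ∷ rest) ≡ reverse rest ++ b ∷ reverse mid ++ a ∷ reverse pre
reverse-split pre a mid b rest = begin
  reverse (pre ++ a ∷ mid ++ b ∷ rest)                   ≡⟨ reverse-++ pre (a ∷ mid ++ b ∷ rest) ⟩
  reverse (a ∷ mid ++ b ∷ rest) ++ reverse pre           ≡⟨ cong (_++ reverse pre) (unfold-reverse a (mid ++ b ∷ rest)) ⟩
  reverse (mid ++ b ∷ rest) ∷ʳ a ++ reverse pre          ≡⟨ ∷ʳ-++ (reverse (mid ++ b ∷ rest)) a (reverse pre) ⟩
  reverse (mid ++ b ∷ rest) ++ a ∷ reverse pre           ≡⟨ cong (_++ a ∷ reverse pre) (reverse-++ mid (b ∷ rest)) ⟩
  (reverse (b ∷ rest) ++ reverse mid) ++ a ∷ reverse pre ≡⟨ ++-assoc (reverse (b ∷ rest)) (reverse mid) (a ∷ reverse pre) ⟩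
  reverse (b ∷ rest) ++ reverse mid ++ a ∷ reverse pre
    ≡⟨ cong (_++ reverse mid ++ a ∷ reverse pre) (unfold-reverse b rest) ⟩
  reverse rest ∷ʳ b ++ reverse mid ++ a ∷ reverse pre    ≡⟨ ∷ʳ-++ (reverse rest) b (reverse mid ++ a ∷ reverse pre) ⟩
  reverse rest ++ b ∷ reverse mid ++ a ∷ reverse pre     ∎
  where open ≡-Reasoning

Unique-resp-↭ : ∀ {A : Set} {xs ys : List A} → xs ↭ ys → Unique xs → Unique ys
Unique-resp-↭ {A} xs↭ys = Permutationₛ.Unique-resp-↭ (setoid A) (↭⇒↭ₛ xs↭ys)

reverse-prefix-↭ : ∀ {A : Set} pre (a : A) ys → a ∷ reverse pre ++ ys ↭ pre ++ a ∷ ys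
reverse-prefix-↭ pre a ys = ↭-trans (prep a (++⁺ʳ ys (↭-reverse pre))) (↭-sym (shift a pre ys))

-- In a path pre ++ a ∷ b ∷ rest from v to v′ with v ~ b and v′ ~ a, the cycle
-- b → … → v′ → a → … → v → b.
crossingCycle : ∀ {A : Set} → List A → A → A → List A → List A
crossingCycle pre a b rest = b ∷ rest ++ a ∷ reverse pre

crossingCycle-↭ : ∀ {A : Set} pre (a b : A) rest → crossingCycle pre a b rest ↭ pre ++ a ∷ b ∷ rest
crossingCycle-↭ pre a b rest = ↭-trans (++-comm (b ∷ rest) (a ∷ reverse pre)) (reverse-prefix-↭ pre a (b ∷ rest))

crossingCycle-skip-↭ : ∀ {A : Set} pre (a c b : A) rest → pre ++ a ∷ c ∷ b ∷ rest ↭ c ∷ crossingCycle pre a b rest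
crossingCycle-skip-↭ pre a c b rest = begin
  pre ++ a ∷ c ∷ b ∷ rest          ≡⟨ sym (∷ʳ-++ pre a (c ∷ b ∷ rest)) ⟩
  (pre ∷ʳ a) ++ [ c ] ++ b ∷ rest  ↭⟨ shift c (pre ∷ʳ a) (b ∷ rest) ⟩
  c ∷ (pre ∷ʳ a) ++ b ∷ rest       ≡⟨ cong (c ∷_) (∷ʳ-++ pre a (b ∷ rest)) ⟩
  c ∷ pre ++ a ∷ b ∷ rest          ↭⟨ prep c (↭-sym (crossingCycle-↭ pre a b rest)) ⟩
  c ∷ crossingCycle pre a b rest   ∎
  where open PermutationReasoning

Cyclic : ∀ {A : Set} → Rel A 0ℓ → List A → Set
Cyclic R []       = ⊤
Cyclic R (x ∷ xs) = Linked R (x ∷ xs ∷ʳ x)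

module _ {A : Set} {R : Rel A 0ℓ} where

  Linked-++⁻ˡ : ∀ xs {ys} → Linked R (xs ++ ys) → Linked R xs
  Linked-++⁻ˡ []           _       = []
  Linked-++⁻ˡ (x ∷ [])     _       = [-]
  Linked-++⁻ˡ (x ∷ y ∷ xs) (r ∷ l) = r ∷ Linked-++⁻ˡ (y ∷ xs) l

  Linked-++⁻ʳ : ∀ xs {ys} → Linked R (xs ++ ys) → Linked R ys
  Linked-++⁻ʳ []       l = l
  Linked-++⁻ʳ (x ∷ xs) l = Linked-++⁻ʳ xs (Linked.tail l)

  Linked-split : ∀ xs {y ys} → Linked R (xs ++ y ∷ ys) → Linked R (xs ∷ʳ y) × Linked R (y ∷ ys)
  Linked-split []           l       = [-] , l
  Linked-split (x ∷ [])     (r ∷ l) = r ∷ [-] , l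
  Linked-split (x ∷ z ∷ xs) (r ∷ l) with l₁ , l₂ ← Linked-split (z ∷ xs) l = r ∷ l₁ , l₂

  Linked-join : ∀ xs {y ys} → Linked R (xs ∷ʳ y) → Linked R (y ∷ ys) → Linked R (xs ++ y ∷ ys)
  Linked-join []           _        l₂ = l₂
  Linked-join (x ∷ [])     (r ∷ _)  l₂ = r ∷ l₂
  Linked-join (x ∷ z ∷ xs) (r ∷ l₁) l₂ = r ∷ Linked-join (z ∷ xs) l₁ l₂

  Linked-∷ʳ : ∀ xs {y z} → Linked R (xs ∷ʳ y) → R y z → Linked R (xs ∷ʳ y ∷ʳ z)
  Linked-∷ʳ xs {y} {z} l r = subst (Linked R) (sym (++-assoc xs [ y ] [ z ])) (Linked-join xs l (r ∷ [-]))

  Cyclic-join : ∀ {x y} xs ys → Linked R (x ∷ xs ∷ʳ y) → Linked R (y ∷ ys ∷ʳ x) → Cyclic R (x ∷ xs ++ y ∷ ys)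
  Cyclic-join {x} {y} xs ys l₁ l₂ =
    subst (Linked R) (sym (++-assoc (x ∷ xs) (y ∷ ys) [ x ])) (Linked-join (x ∷ xs) l₁ l₂)

  Cyclic-open : ∀ us {q ws} → Cyclic R (us ++ q ∷ ws) → Linked R (q ∷ ws ++ us)
  Cyclic-open []       {q} {ws} c = subst (Linked R) (sym (++-identityʳ (q ∷ ws))) (Linked-++⁻ˡ (q ∷ ws) c)
  Cyclic-open (u ∷ us) {q} {ws} c
    with l₁ , l₂ ← Linked-split (u ∷ us) (subst (Linked R) (++-assoc (u ∷ us) (q ∷ ws) [ u ]) c) =
    Linked-++⁻ˡ (q ∷ ws ++ u ∷ us)
      (subst (Linked R) (sym (++-assoc (q ∷ ws) (u ∷ us) [ q ])) (Linked-join (q ∷ ws) l₂ l₁))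

  module _ (R-sym : Symmetric R) where

    Linked-reverse : ∀ {xs} → Linked R xs → Linked R (reverse xs)
    Linked-reverse []                   = []
    Linked-reverse [-]                  = [-]
    Linked-reverse {x ∷ y ∷ ys} (r ∷ l) =
      subst (Linked R) (sym (trans (unfold-reverse x (y ∷ ys)) (cong (_∷ʳ x) (unfold-reverse y ys))))
        (Linked-∷ʳ (reverse ys) (subst (Linked R) (unfold-reverse y ys) (Linked-reverse l)) (R-sym r))

    Linked-reverse-prefix : ∀ {x xs} pre {a ys b} → Linked R (x ∷ xs) → x ∷ xs ≡ pre ++ a ∷ ys → R x b →
                            Linked R (a ∷ reverse pre ∷ʳ b)
    Linked-reverse-prefix []        _ refl r = r ∷ [-]
    Linked-reverse-prefix (x ∷ pre) {a} {ys} {b} l refl r =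
      subst (λ zs → Linked R (a ∷ zs ∷ʳ b)) (sym (unfold-reverse x pre)) (Linked-∷ʳ (a ∷ reverse pre) back r)
      where
      back : Linked R (a ∷ reverse pre ∷ʳ x)
      back = subst (Linked R) (trans (reverse-++ (x ∷ pre) [ a ]) (cong (a ∷_) (unfold-reverse x pre)))
               (Linked-reverse (Linked-++⁻ˡ (x ∷ pre ∷ʳ a) (subst (Linked R) (sym (∷ʳ-++ (x ∷ pre) a ys)) l)))

    Cyclic-crossingCycle : ∀ {x xs z zs} pre {a} mid {b} rest → Linked R (x ∷ xs) → reverse (x ∷ xs) ≡ z ∷ zs →
                           x ∷ xs ≡ pre ++ a ∷ mid ++ b ∷ rest → R x b → R z a → Cyclic R (crossingCycle pre a b rest)
    Cyclic-crossingCycle pre {a} mid {b} rest l rev≡ split≡ xb za = Cyclic-join rest (reverse pre) forth back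
      where
      back : Linked R (a ∷ reverse pre ∷ʳ b)
      back = Linked-reverse-prefix pre l split≡ xb
      forth : Linked R (b ∷ rest ∷ʳ a)
      forth = subst (λ ys → Linked R (b ∷ ys ∷ʳ a)) (reverse-involutive rest)
                (Linked-reverse-prefix (reverse rest) (subst (Linked R) rev≡ (Linked-reverse l))
                  (trans (sym rev≡) (trans (cong reverse split≡) (reverse-split pre a mid b rest))) za)

-- Applied with x, y, s the neighbourhoods of v, v′ and u along P.  Charging each x-label to
-- the preceding vertex, every vertex pays for at most one label, except those carrying both
-- y and s; such a vertex is compensated by the first vertex after its run of y's, which
-- carries no label at all (suffix-weight<).
module ThreeLabellings {A : Set} (P : List A) (x y s : A → Bool)
  (x-head : ∀ {a rest} → P ≡ a ∷ rest → ¬ T (x a))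
  (y-last : ∀ pre {a} → P ≡ pre ∷ʳ a → ¬ T (y a))
  (y-x : ∀ pre {a b rest} → P ≡ pre ++ a ∷ b ∷ rest → T (y a) → ¬ T (x b))
  (s-x : ∀ pre {a b rest} → P ≡ pre ++ a ∷ b ∷ rest → T (s a) → ¬ T (x b))
  (y-s : ∀ pre {a b rest} → P ≡ pre ++ a ∷ b ∷ rest → T (y a) → ¬ T (s b))
  (s…y-x : ∀ pre {a c b rest q} → P ≡ pre ++ a ∷ c ∷ b ∷ rest →
           q ∈ pre ∷ʳ a → T (s q) → T (y a) → ¬ T (x b))
  where

  weight : A → ℕ
  weight a = toℕ (x a) + (toℕ (y a) + toℕ (s a))

  totalWeight : List A → ℕ
  totalWeight as = sum (map weight as)

  weight≡y : ∀ {a} → ¬ T (x a) → ¬ T (s a) → weight a ≡ toℕ (y a)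
  weight≡y {a} ¬xa ¬sa rewrite toℕ-¬T ¬xa | toℕ-¬T ¬sa = +-identityʳ (toℕ (y a))

  totalWeight≡counts : ∀ as → totalWeight as ≡ countᵇ x as + countᵇ y as + countᵇ s as
  totalWeight≡counts []       = refl
  totalWeight≡counts (a ∷ as) rewrite totalWeight≡counts as =
    solve 6 (λ xa ya sa cx cy cs → (xa :+ (ya :+ sa)) :+ (cx :+ cy :+ cs) := (xa :+ cx) :+ (ya :+ cy) :+ (sa :+ cs))
      refl (toℕ (x a)) (toℕ (y a)) (toℕ (s a)) (countᵇ x as) (countᵇ y as) (countᵇ s as)
    where open +-*-Solver

  advance : ∀ pre {a rest} → P ≡ pre ++ a ∷ rest → P ≡ (pre ∷ʳ a) ++ rest
  advance pre {a} {rest} P≡ = trans P≡ (sym (∷ʳ-++ pre a rest))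

  suffix-weight≤ : ∀ pre {a rest} → P ≡ pre ++ a ∷ rest → totalWeight (a ∷ rest) ≤ toℕ (x a) + length (a ∷ rest)
  suffix-weight< : ∀ pre {p q a rest} → P ≡ pre ++ p ∷ a ∷ rest → q ∈ pre ∷ʳ p → T (s q) → T (y p) →
                   totalWeight (a ∷ rest) < length (a ∷ rest)

  suffix-weight≤length : ∀ pre {a rest} → P ≡ pre ++ a ∷ rest → ¬ T (x a) →
                         totalWeight (a ∷ rest) ≤ length (a ∷ rest)
  suffix-weight≤length pre {a} P≡ ¬xa with x a | suffix-weight≤ pre P≡
  ... | false | bound = bound
  ... | true  | _     = ⊥-elim (¬xa _)

  suffix-weight≤ pre {a} {[]} P≡ = begin
    weight a + 0                         ≡⟨ +-identityʳ (weight a) ⟩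
    toℕ (x a) + (toℕ (y a) + toℕ (s a))  ≤⟨ +-monoʳ-≤ (toℕ (x a)) excess ⟩
    toℕ (x a) + 1                        ∎
    where
    open ≤-Reasoning
    excess : toℕ (y a) + toℕ (s a) ≤ 1
    excess with y a in ya
    ... | true  = ⊥-elim (y-last pre P≡ (true⇒T ya))
    ... | false = toℕ≤1 (s a)
  suffix-weight≤ pre {a} {b ∷ rest} P≡ = begin
    weight a + totalWeight (b ∷ rest)                             ≡⟨ +-assoc (toℕ (x a)) _ _ ⟩
    toℕ (x a) + (toℕ (y a) + toℕ (s a) + totalWeight (b ∷ rest))  ≤⟨ +-monoʳ-≤ (toℕ (x a)) excess ⟩
    toℕ (x a) + suc (length (b ∷ rest))                           ∎
    where
    open ≤-Reasoning
    next : P ≡ (pre ∷ʳ a) ++ b ∷ rest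
    next = advance pre P≡
    excess : toℕ (y a) + toℕ (s a) + totalWeight (b ∷ rest) ≤ suc (length (b ∷ rest))
    excess with y a in ya | s a in sa
    ... | true  | true  = s≤s (suffix-weight< pre P≡ (∈-++⁺ʳ pre (here refl)) (true⇒T sa) (true⇒T ya))
    ... | true  | false = s≤s (suffix-weight≤length (pre ∷ʳ a) next (y-x pre P≡ (true⇒T ya)))
    ... | false | true  = s≤s (suffix-weight≤length (pre ∷ʳ a) next (s-x pre P≡ (true⇒T sa)))
    ... | false | false = ≤-trans (suffix-weight≤ (pre ∷ʳ a) next) (+-monoˡ-≤ _ (toℕ≤1 (x b)))

  suffix-weight< pre {p} {a = a} {[]} P≡ _ _ yp = s≤s (≤-reflexive (begin
    weight a + 0  ≡⟨ +-identityʳ (weight a) ⟩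
    weight a      ≡⟨ weight≡y (y-x pre P≡ yp) (y-s pre P≡ yp) ⟩
    toℕ (y a)     ≡⟨ toℕ-¬T (y-last (pre ∷ʳ p) (advance pre P≡)) ⟩
    0             ∎))
    where open ≡-Reasoning
  suffix-weight< pre {p} {q} {a} {b ∷ rest} P≡ q∈ sq yp rewrite weight≡y (y-x pre P≡ yp) (y-s pre P≡ yp) with y a in ya
  ... | true  = s≤s (suffix-weight< (pre ∷ʳ p) (advance pre P≡) (∈-++⁺ˡ q∈) sq (true⇒T ya))
  ... | false = s≤s (suffix-weight≤length ((pre ∷ʳ p) ∷ʳ a) (advance (pre ∷ʳ p) (advance pre P≡))
                                          (s…y-x pre P≡ q∈ sq yp))

  counts≤length : countᵇ x P + countᵇ y P + countᵇ s P ≤ length P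
  counts≤length = subst (_≤ length P) (totalWeight≡counts P) (totalWeight≤length P refl)
    where
    totalWeight≤length : ∀ as → P ≡ as → totalWeight as ≤ length as
    totalWeight≤length []       _  = z≤n
    totalWeight≤length (a ∷ as) P≡ = suffix-weight≤length [] P≡ (x-head P≡)

-- Longest paths inside a vertex set

minFin-≤ : ∀ {m} (f : Fin (suc m) → ℕ) i → minFin f ≤ f i
minFin-≤ {zero}  f zero    = ≤-refl
minFin-≤ {suc m} f zero    = m⊓n≤m (f zero) _
minFin-≤ {suc m} f (suc i) = ≤-trans (m⊓n≤n (f zero) _) (minFin-≤ (f ∘ suc) i)

δ≤degree : ∀ {n} (G : Graph n) v → δ G ≤ degree G v
δ≤degree {suc n} G v = minFin-≤ (degree G) v

≢[]? : ∀ {A : Set} (xs : List A) → Dec (xs ≢ [])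
≢[]? []      = no (λ []≢[] → []≢[] refl)
≢[]? (_ ∷ _) = yes (λ ())

module Paths {n} (G : Graph n) where

  open DecMembership (_≟_ {n}) using (_∈?_)

  Adj-sym : Symmetric (Adj G)
  Adj-sym {u} {v} = subst T (Graph.sym G u v)

  Adj-irrefl : ∀ {v} → ¬ Adj G v v
  Adj-irrefl {v} = subst T (Graph.irrefl G v)

  degree≤countᵇ : ∀ {v vs} → Unique vs → (∀ {w} → Adj G v w → w ∈ vs) → degree G v ≤ countᵇ (adj G v) vs
  degree≤countᵇ {v} {vs} vs! N[v]⊆vs = begin
    degree G v                  ≡⟨ ∣tabulate∣≡countᵇ (adj G v) id ⟩
    countᵇ (adj G v) (allFin n) ≤⟨ countᵇ-mono (adj G v) (Uniqueₚ.allFin⁺ n) (λ _ → N[v]⊆vs) ⟩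
    countᵇ (adj G v) vs         ∎
    where open ≤-Reasoning

  module Within (U : Fin n → Set) where

    IsPathWithin : List (Fin n) → Set
    IsPathWithin P = IsPath G P × All U P

    IsLongestWithin : List (Fin n) → Set
    IsLongestWithin P = IsPathWithin P × (∀ {Q} → IsPathWithin Q → length Q ≤ length P)

    IsPathWithin-singleton : ∀ {x} → U x → IsPathWithin [ x ]
    IsPathWithin-singleton Ux = ((λ ()) , [] ∷ [] , [-]) , Ux ∷ []

    IsPathWithin-edge : ∀ {x y} → U x → Adj G x y → U y → IsPathWithin (x ∷ y ∷ [])
    IsPathWithin-edge Ux xy Uy = ((λ ()) , ((λ { refl → Adj-irrefl xy }) ∷ []) ∷ [] ∷ [] , xy ∷ [-]) , Ux ∷ Uy ∷ []

    isPathWithin? : Decidable U → Decidable IsPathWithin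
    isPathWithin? U? P = (≢[]? P ×-dec unique? _≟_ P ×-dec linked? (λ u v → T? (adj G u v)) P) ×-dec all? U? P

    longestWithin : Decidable U → ∀ {P₀} → IsPathWithin P₀ →
                    Σ (Fin n) λ u → Σ (List (Fin n)) λ Q → IsLongestWithin (u ∷ Q) × length P₀ ≤ length (u ∷ Q)
    longestWithin U? P₀-path
      with longest (allFin n) ∈-allFin (isPathWithin? U?) n (λ ((_ , P! , _) , _) → Unique⇒length≤ P!) P₀-path
    ... | [] , ((nonempty , _) , _) , _ = ⊥-elim (nonempty refl)
    ... | u ∷ Q , Q-longest@(_ , maximal) = u , Q , Q-longest , maximal P₀-path

    IsPathWithin-↭ : ∀ {P Q} → Linked (Adj G) Q → Q ↭ P → P ≢ [] → Unique P → All U P → IsPathWithin Q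
    IsPathWithin-↭ Q-linked Q↭P P≢[] P! P⊆U =
      ( (λ Q≡[] → P≢[] (↭-empty-inv (↭-sym (subst (_↭ _) Q≡[] Q↭P))))
      , Unique-resp-↭ (↭-sym Q↭P) P!
      , Q-linked ) ,
      All-resp-↭ (↭-sym Q↭P) P⊆U

    IsLongestWithin-↭ : ∀ {P Q} → Linked (Adj G) Q → Q ↭ P → IsLongestWithin P → IsLongestWithin Q
    IsLongestWithin-↭ Q-linked Q↭P (((P≢[] , P! , _) , P⊆U) , maximal) =
      IsPathWithin-↭ Q-linked Q↭P P≢[] P! P⊆U , λ R → subst (_ ≤_) (sym (↭-length Q↭P)) (maximal R)

    IsLongestWithin-reverse : ∀ {P} → IsLongestWithin P → IsLongestWithin (reverse P)
    IsLongestWithin-reverse {P} P-longest@(((_ , _ , P-linked) , _) , _) =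
      IsLongestWithin-↭ (Linked-reverse Adj-sym P-linked) (↭-reverse P) P-longest

    N[head]⊆longest : ∀ {h P w} → IsLongestWithin (h ∷ P) → Adj G h w → U w → w ∈ h ∷ P
    N[head]⊆longest {h} {P} {w} (((_ , P! , P-linked) , P⊆U) , maximal) hw Uw with w ∈? (h ∷ P)
    ... | yes w∈P = w∈P
    ... | no  w∉P = ⊥-elim (<⇒≱ ≤-refl (maximal extended))
      where
      extended : IsPathWithin (w ∷ h ∷ P)
      extended = ((λ ()) , ¬Any⇒All¬ _ w∉P ∷ P! , Adj-sym hw ∷ P-linked) , Uw ∷ P⊆U

    -- Pósa rotation: a ∷ reverse pre ++ b ∷ rest is again a longest path, now starting at a.
    N[rotated-head]⊆longest : ∀ {v P} pre {a b rest w} → IsLongestWithin (v ∷ P) → v ∷ P ≡ pre ++ a ∷ b ∷ rest →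
                    Adj G v b → Adj G a w → U w → w ∈ v ∷ P
    N[rotated-head]⊆longest {v} {P} pre {a} {b} {rest} P-longest@(((_ , _ , P-linked) , _) , _) P≡ vb aw Uw =
      ∈-resp-↭ rotated↭P (N[head]⊆longest (IsLongestWithin-↭ rotated-linked rotated↭P P-longest) aw Uw)
      where
      rotated↭P : a ∷ reverse pre ++ b ∷ rest ↭ v ∷ P
      rotated↭P = ↭-trans (reverse-prefix-↭ pre a (b ∷ rest)) (↭-reflexive (sym P≡))
      rotated-linked : Linked (Adj G) (a ∷ reverse pre ++ b ∷ rest)
      rotated-linked = Linked-join (a ∷ reverse pre) (Linked-reverse-prefix Adj-sym pre P-linked P≡ vb)
                         (Linked.tail (Linked-++⁻ʳ pre (subst (Linked (Adj G)) P≡ P-linked)))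

    cycle+path≤longest : ∀ {P K u Q q} → IsLongestWithin P → Cyclic (Adj G) K → Unique K → All U K →
                         IsPathWithin (u ∷ Q) → Disjoint (u ∷ Q) K → q ∈ K → Adj G u q →
                         length (u ∷ Q) + length K ≤ length P
    cycle+path≤longest {P} {K} {u} {Q} {q} (_ , maximal) K-cyclic K! K⊆U ((_ , uQ! , uQ-linked) , uQ⊆U) uQ∩K≡∅ q∈K uq
      with us , ws , refl ← ∈-∃++ q∈K =
      subst (_≤ length P) (trans (↭-length L↭uQ++K) (length-++ (u ∷ Q))) (maximal L-path)
      where
      L : List (Fin n)
      L = reverse Q ++ u ∷ q ∷ ws ++ us
      L-linked : Linked (Adj G) L
      L-linked = Linked-join (reverse Q) (subst (Linked (Adj G)) (unfold-reverse u Q) (Linked-reverse Adj-sym uQ-linked))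
                   (uq ∷ Cyclic-open us K-cyclic)
      L↭uQ++K : L ↭ (u ∷ Q) ++ us ++ q ∷ ws
      L↭uQ++K = begin
        reverse Q ++ u ∷ q ∷ ws ++ us  ↭⟨ shift u (reverse Q) (q ∷ ws ++ us) ⟩
        u ∷ reverse Q ++ q ∷ ws ++ us  ↭⟨ prep u (++⁺ʳ (q ∷ ws ++ us) (↭-reverse Q)) ⟩
        u ∷ Q ++ q ∷ ws ++ us          ↭⟨ prep u (++⁺ˡ Q (++-comm (q ∷ ws) us)) ⟩
        u ∷ Q ++ us ++ q ∷ ws          ∎
        where open PermutationReasoning
      L-path : IsPathWithin L
      L-path = IsPathWithin-↭ L-linked L↭uQ++K (λ ()) (Uniqueₚ.++⁺ uQ! K! uQ∩K≡∅) (Allₚ.++⁺ uQ⊆U K⊆U)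

-- Long paths in a component

Star-exit : ∀ {A : Set} {R : Rel A 0ℓ} {I P : A → Set} → (∀ {a b} → I a → R a b → I b) → Decidable P →
            ∀ {x y} → Star R x y → I x → ¬ P x → P y → Σ A λ w → Σ A λ p → I w × ¬ P w × R w p × P p
Star-exit closed P? ε                   Ix ¬Px Py = ⊥-elim (¬Px Py)
Star-exit closed P? (_◅_ {j = z} xz zy) Ix ¬Px Py with P? z
... | yes Pz  = _ , z , Ix , ¬Px , xz , Pz
... | no  ¬Pz = Star-exit closed P? zy (closed Ix xz) ¬Pz Py

OffPath : ∀ {n} → Subset n → List (Fin n) → Fin n → Set
OffPath C P x = x ∈ₛ C × x ∉ P

module _ {n} {G : Graph n} {C : Subset n} where

  open Paths G
  open Within (_∈ₛ C)
  open DecMembership (_≟_ {n}) using (_∈?_)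

  module TwoLongestPaths
    (C-closed : ∀ {x y} → x ∈ₛ C → Adj G x y → y ∈ₛ C)
    {v P₁ v′ P′} (P-longest : IsLongestWithin (v ∷ P₁)) (P-rev : reverse (v ∷ P₁) ≡ v′ ∷ P′)
    {u Q} (Q-longest : Within.IsLongestWithin (OffPath C (v ∷ P₁)) (u ∷ Q)) (|Q|≥1 : 1 ≤ length Q)
    {w p} (w-off : OffPath C (v ∷ P₁) w) (p∈P : p ∈ v ∷ P₁) (wp : Adj G w p)
    where

    P : List (Fin n)
    P = v ∷ P₁

    P-path : IsPath G P
    P-path = proj₁ (proj₁ P-longest)

    P! : Unique P
    P! = proj₁ (proj₂ P-path)

    P-linked : Linked (Adj G) P
    P-linked = proj₂ (proj₂ P-path)

    P⊆C : All (_∈ₛ C) P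
    P⊆C = proj₂ (proj₁ P-longest)

    uQ-path : Within.IsPathWithin (OffPath C P) (u ∷ Q)
    uQ-path = proj₁ Q-longest

    u∈C : u ∈ₛ C
    u∈C = proj₁ (head (proj₂ uQ-path))

    u∉P : u ∉ P
    u∉P = proj₂ (head (proj₂ uQ-path))

    uQ∩P≡∅ : Disjoint (u ∷ Q) P
    uQ∩P≡∅ (x∈uQ , x∈P) = proj₂ (lookup (proj₂ uQ-path) x∈uQ) x∈P

    reverse-P-longest : IsLongestWithin (v′ ∷ P′)
    reverse-P-longest = subst IsLongestWithin P-rev (IsLongestWithin-reverse P-longest)

    ∈-reverse-P : ∀ {x} → x ∈ v′ ∷ P′ → x ∈ P
    ∈-reverse-P = ∈-resp-↭ (↭-trans (↭-reflexive (sym P-rev)) (↭-reverse P))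

    N[v]⊆P : ∀ {x} → Adj G v x → x ∈ P
    N[v]⊆P vx = N[head]⊆longest P-longest vx (C-closed (head P⊆C) vx)

    N[v′]⊆P : ∀ {x} → Adj G v′ x → x ∈ P
    N[v′]⊆P v′x = ∈-reverse-P (N[head]⊆longest reverse-P-longest v′x (C-closed v′∈C v′x))
      where
      v′∈C : v′ ∈ₛ C
      v′∈C = lookup P⊆C (∈-reverse-P (here refl))

    N[u]⊆P++uQ : ∀ {x} → Adj G u x → x ∈ P ++ u ∷ Q
    N[u]⊆P++uQ {x} ux with x ∈? P
    ... | yes x∈P = ∈-++⁺ˡ x∈P
    ... | no  x∉P = ∈-++⁺ʳ P (Within.N[head]⊆longest (OffPath C P) Q-longest ux (C-closed u∈C ux , x∉P))

    v-not-adjacent-head : ∀ {a rest} → P ≡ a ∷ rest → ¬ Adj G v a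
    v-not-adjacent-head refl = Adj-irrefl

    v′-not-adjacent-last : ∀ pre {a} → P ≡ pre ∷ʳ a → ¬ Adj G v′ a
    v′-not-adjacent-last pre {a} P≡
      with refl ← ∷-injectiveˡ (trans (sym P-rev) (trans (cong reverse P≡) (reverse-++ pre [ a ]))) = Adj-irrefl

    -- The crossing cycle runs through all of V(P); attaching w to it gives a longer path.
    crossing-not-closable : ∀ pre {a b rest} → P ≡ pre ++ a ∷ b ∷ rest → Adj G v′ a → ¬ Adj G v b
    crossing-not-closable pre {a} {b} {rest} P≡ v′a vb = 1+n≰n (begin
      suc (length P) ≡⟨ cong suc (sym (↭-length K↭P)) ⟩
      suc (length K) ≤⟨ cycle+path≤longest P-longest K-cyclic K! K⊆C (IsPathWithin-singleton (proj₁ w-off))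
                          w∩K≡∅ (∈-resp-↭ (↭-sym K↭P) p∈P) wp ⟩
      length P       ∎)
      where
      open ≤-Reasoning
      K : List (Fin n)
      K = crossingCycle pre a b rest
      K↭P : K ↭ P
      K↭P = ↭-trans (crossingCycle-↭ pre a b rest) (↭-reflexive (sym P≡))
      K-cyclic : Cyclic (Adj G) K
      K-cyclic = Cyclic-crossingCycle Adj-sym pre [] rest P-linked P-rev P≡ vb v′a
      K! : Unique K
      K! = Unique-resp-↭ (↭-sym K↭P) P!
      K⊆C : All (_∈ₛ C) K
      K⊆C = All-resp-↭ (↭-sym K↭P) P⊆C
      w∩K≡∅ : Disjoint [ w ] K
      w∩K≡∅ (here refl , w∈K) = proj₂ w-off (∈-resp-↭ K↭P w∈K)

    rotation-avoids-u : ∀ pre {a b rest} → P ≡ pre ++ a ∷ b ∷ rest → Adj G u a → ¬ Adj G v b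
    rotation-avoids-u pre P≡ ua vb = u∉P (N[rotated-head]⊆longest pre P-longest P≡ vb (Adj-sym ua) u∈C)

    reverse-rotation-avoids-u : ∀ pre {a b rest} → P ≡ pre ++ a ∷ b ∷ rest → Adj G v′ a → ¬ Adj G u b
    reverse-rotation-avoids-u pre {a} {b} {rest} P≡ v′a ub =
      u∉P (∈-reverse-P (N[rotated-head]⊆longest (reverse rest) reverse-P-longest reverse-P≡ v′a (Adj-sym ub) u∈C))
      where
      reverse-P≡ : v′ ∷ P′ ≡ reverse rest ++ b ∷ a ∷ reverse pre
      reverse-P≡ = trans (sym P-rev) (trans (cong reverse P≡) (reverse-split pre a [] b rest))

    -- Skipping c, the crossing cycle misses one vertex of P, and attaching u ∷ Q to it
    -- gains at least two.
    skipping-crossing-avoids-u : ∀ pre {a c b rest q} → P ≡ pre ++ a ∷ c ∷ b ∷ rest → q ∈ pre ∷ʳ a → Adj G u q →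
                                 Adj G v′ a → ¬ Adj G v b
    skipping-crossing-avoids-u pre {a} {c} {b} {rest} {q} P≡ q∈ uq v′a vb = <-irrefl refl (begin-strict
      suc (length K)       ≤⟨ +-monoˡ-≤ (length K) |Q|≥1 ⟩
      length Q + length K  <⟨ cycle+path≤longest P-longest K-cyclic K! K⊆C uQ-path-in-C uQ∩K≡∅ q∈K uq ⟩
      length P             ≡⟨ ↭-length P↭cK ⟩
      suc (length K)       ∎)
      where
      open ≤-Reasoning
      K : List (Fin n)
      K = crossingCycle pre a b rest
      P↭cK : P ↭ c ∷ K
      P↭cK = ↭-trans (↭-reflexive P≡) (crossingCycle-skip-↭ pre a c b rest)
      K-cyclic : Cyclic (Adj G) K
      K-cyclic = Cyclic-crossingCycle Adj-sym pre [ c ] rest P-linked P-rev P≡ vb v′a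
      K! : Unique K
      K! with _ ∷ K! ← Unique-resp-↭ P↭cK P! = K!
      K⊆C : All (_∈ₛ C) K
      K⊆C with _ ∷ K⊆C ← All-resp-↭ P↭cK P⊆C = K⊆C
      uQ-path-in-C : IsPathWithin (u ∷ Q)
      uQ-path-in-C = proj₁ uQ-path , All.map proj₁ (proj₂ uQ-path)
      uQ∩K≡∅ : Disjoint (u ∷ Q) K
      uQ∩K≡∅ (x∈uQ , x∈K) = uQ∩P≡∅ (x∈uQ , ∈-resp-↭ (↭-sym P↭cK) (there x∈K))
      q∈K : q ∈ K
      q∈K = ∈-resp-↭ (↭-sym (crossingCycle-↭ pre a b rest)) (subst (q ∈_) (∷ʳ-++ pre a (b ∷ rest)) (∈-++⁺ˡ q∈))

    open ThreeLabellings P (adj G v) (adj G v′) (adj G u) v-not-adjacent-head v′-not-adjacent-last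
      crossing-not-closable rotation-avoids-u reverse-rotation-avoids-u skipping-crossing-avoids-u
      using (counts≤length)

    degree-u≤ : degree G u ≤ countᵇ (adj G u) P + length Q
    degree-u≤ = begin
      degree G u                                    ≤⟨ degree≤countᵇ P++uQ! N[u]⊆P++uQ ⟩
      countᵇ (adj G u) (P ++ u ∷ Q)                 ≡⟨ countᵇ-++ (adj G u) P (u ∷ Q) ⟩
      countᵇ (adj G u) P + countᵇ (adj G u) (u ∷ Q) ≤⟨ +-monoʳ-≤ (countᵇ (adj G u) P) N[u]∩uQ≤ ⟩
      countᵇ (adj G u) P + length Q                 ∎
      where
      open ≤-Reasoning
      P++uQ! : Unique (P ++ u ∷ Q)
      P++uQ! = Uniqueₚ.++⁺ P! (proj₁ (proj₂ (proj₁ uQ-path))) (λ (x∈P , x∈uQ) → uQ∩P≡∅ (x∈uQ , x∈P))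
      N[u]∩uQ≤ : countᵇ (adj G u) (u ∷ Q) ≤ length Q
      N[u]∩uQ≤ rewrite Graph.irrefl G u = countᵇ≤length (adj G u) Q

    3δ<|P|+|uQ| : 3 * δ G < length P + length (u ∷ Q)
    3δ<|P|+|uQ| = begin-strict
      3 * δ G                                      ≡⟨ solve 1 (λ d → con 3 :* d := d :+ d :+ d) refl (δ G) ⟩
      δ G + δ G + δ G                              ≤⟨ +-mono-≤ (+-mono-≤ (δ≤degree G v) (δ≤degree G v′))
                                                                (δ≤degree G u) ⟩
      degree G v + degree G v′ + degree G u        ≤⟨ +-mono-≤ (+-mono-≤ (degree≤countᵇ P! N[v]⊆P)
                                                                          (degree≤countᵇ P! N[v′]⊆P))
                                                                degree-u≤ ⟩
      cx + cy + (cs + length Q)                    ≡⟨ sym (+-assoc (cx + cy) cs (length Q)) ⟩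
      cx + cy + cs + length Q                      ≤⟨ +-monoˡ-≤ (length Q) counts≤length ⟩
      length P + length Q                          <⟨ +-monoʳ-< (length P) (n<1+n (length Q)) ⟩
      length P + length (u ∷ Q)                    ∎
      where
      open ≤-Reasoning
      open +-*-Solver
      cx cy cs : ℕ
      cx = countᵇ (adj G v) P
      cy = countᵇ (adj G v′) P
      cs = countᵇ (adj G u) P

  Absorbs : List (Fin n) → Set
  Absorbs P = ∀ v → v ∈ₛ C → v ∉ P → ∀ u → Adj G v u → u ∈ P

  absorbs-or-edge-off : ∀ P → Absorbs P ⊎ Σ (Fin n) λ x → Σ (Fin n) λ y → OffPath C P x × Adj G x y × y ∉ P
  absorbs-or-edge-off P
    with any? (λ x → any? (λ y → ((x ∈ₛ? C) ×-dec ¬? (x ∈? P)) ×-dec (T? (adj G x y) ×-dec ¬? (y ∈? P))))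
  ... | yes (x , y , edge) = inj₂ (x , y , edge)
  ... | no  ∄edge = inj₁ λ x x∈C x∉P y xy →
    decidable-stable (y ∈? P) λ y∉P → ∄edge (x , y , (x∈C , x∉P) , xy , y∉P)

  longest-off-path : ∀ {P x y} → OffPath C P x → Adj G x y → OffPath C P y →
                     Σ (Fin n) λ u → Σ (List (Fin n)) λ Q → Within.IsLongestWithin (OffPath C P) (u ∷ Q) × 1 ≤ length Q
  longest-off-path {P} x-off xy y-off
    with u , Q , Q-longest , 2≤|uQ| ← Within.longestWithin (OffPath C P) (λ z → z ∈ₛ? C ×-dec ¬? (z ∈? P))
                                         (Within.IsPathWithin-edge (OffPath C P) x-off xy y-off) =
    u , Q , Q-longest , s≤s⁻¹ 2≤|uQ|

  edge-into-path : IsComponent G C → ∀ {P u v} → OffPath C P u → v ∈ₛ C → v ∈ P →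
                   Σ (Fin n) λ w → Σ (Fin n) λ p → OffPath C P w × p ∈ P × Adj G w p
  edge-into-path (_ , connected , closed) {P} {u} {v} (u∈C , u∉P) v∈C v∈P
    with w , p , w∈C , w∉P , wp , p∈P
           ← Star-exit (λ {a} {b} → closed a b) (_∈? P) (connected u v u∈C v∈C) u∈C u∉P v∈P =
    w , p , (w∈C , w∉P) , p∈P , wp

  absorbing-path-or-two-long-paths : IsComponent G C →
    (Σ (List (Fin n)) λ P → IsPathIn G C P × Absorbs P) ⊎
    (Σ (List (Fin n)) λ P → Σ (List (Fin n)) λ Q →
       IsPath G P × IsPath G Q × (∀ v → v ∈ P → v ∉ Q) × 3 * δ G < length P + length Q)
  absorbing-path-or-two-long-paths component@((c , c∈C) , _ , closed)
    with v , P₁ , P-longest , _ ← longestWithin (_∈ₛ? C) (IsPathWithin-singleton c∈C)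
    with absorbs-or-edge-off (v ∷ P₁)
  ... | inj₁ absorbs = inj₁ (v ∷ P₁ , proj₁ P-longest , absorbs)
  ... | inj₂ (x , y , x-off , xy , y∉P)
    with u , Q , Q-longest , |Q|≥1 ← longest-off-path x-off xy (closed x y (proj₁ x-off) xy , y∉P)
    with w , p , w-off , p∈P , wp
           ← edge-into-path component (head (proj₂ (proj₁ Q-longest))) (head (proj₂ (proj₁ P-longest))) (here refl)
    with v′ , P′ , P-rev ← reverse-∷ v P₁ =
    inj₂ (v ∷ P₁ , u ∷ Q , proj₁ (proj₁ P-longest) , proj₁ (proj₁ Q-longest) ,
          (λ z z∈P z∈uQ → proj₂ (lookup (proj₂ (proj₁ Q-longest)) z∈uQ) z∈P) ,
          TwoLongestPaths.3δ<|P|+|uQ| (λ {a} {b} → closed a b) P-longest P-rev Q-longest |Q|≥1 w-off p∈P wp)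

theorem3p13 : ∀ {n} (G : Graph n) (C : Subset n) →
    IsComponent G C →
    2 * δ G ≤ ∣ C ∣ₛ →
    ¬ (Σ (List (Fin n)) λ P → IsHamPathIn G C P) →
    (Σ (List (Fin n)) λ P₁ → IsPathIn G C P₁ ×
       (∀ v → v ∈ₛ C → v ∉ P₁ → ∀ u → Adj G v u → u ∈ P₁))
    ⊎
    (Σ (List (Fin n)) λ P₁ → Σ (List (Fin n)) λ P₂ →
       IsPath G P₁ × IsPath G P₂ × (∀ v → v ∈ P₁ → v ∉ P₂) ×
       3 * δ G < length P₁ + length P₂)
theorem3p13 G C component _ _ = absorbing-path-or-two-long-paths component
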